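{- For every positive integer $n$, the $n \times n$ square can be tiled with T-tetrominos and at most $5$ monominos.
   Context: A T-tetromino is a polyomino made of four unit squares, three in a row and a fourth attached to the middle square of that row on one side, in any rotation or reflection. A monomino is a single unit square. A tiling of a region made of unit lattice squares is a placement of tiles aligned with the unit grid such that the tiles are pairwise non-overlapping and their union is exactly the region. -}

module Defs where

open import Data.Nat using (ℕ; _<_; _≤_)
open import Data.Integer using (ℤ; +_; _+_; -_; 0ℤ; 1ℤ; -1ℤ)
open import Data.Product using (_×_; _,_; Σ; ∃; ∃-syntax)
open import Data.List using (List; []; _∷_; length; filter)
open import Data.List.Membership.Propositional using (_∈_)
open import Data.List.Relation.Unary.Any using (any?)
open import Relation.Binary.PropositionalEquality using (_≡_)

-- A unit lattice square is identified by its lower-left corner, a point of ℤ².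
Cell : Set
Cell = ℤ × ℤ

InSquare : ℕ → Cell → Set
InSquare n (x , y) = Σ ℕ λ i → Σ ℕ λ j → (i < n) × (j < n) × (x ≡ + i) × (y ≡ + j)

data Dir : Set where
  up down left right : Dir

step : Dir → Cell → Cell
step up    (x , y) = (x , y + 1ℤ)
step down  (x , y) = (x , y + -1ℤ)
step left  (x , y) = (x + -1ℤ , y)
step right (x , y) = (x + 1ℤ , y)

-- Tiles placed on the grid.
--   mono c       : the monomino occupying cell c
--   tee c d      : the T-tetromino whose "middle square of the row of three"
--                  is c, and whose fourth square sticks out in direction d.
-- The four directions give all rotations/reflections of the T-tetromino.
data Tile : Set where
  mono : Cell → Tile
  tee  : Cell → Dir → Tile

cells : Tile → List Cell
cells (mono c) = c ∷ []
cells (tee c up)    = c ∷ step left c ∷ step right c ∷ step up c ∷ []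
cells (tee c down)  = c ∷ step left c ∷ step right c ∷ step down c ∷ []
cells (tee c left)  = c ∷ step up c ∷ step down c ∷ step left c ∷ []
cells (tee c right) = c ∷ step up c ∷ step down c ∷ step right c ∷ []

numMono : List Tile → ℕ
numMono [] = 0
numMono (mono _ ∷ ts) = Data.Nat.suc (numMono ts)
numMono (tee _ _ ∷ ts) = numMono ts

-- A tiling of the region R is a finite list of tiles such that every
-- cell of R lies in exactly one tile and every cell outside R lies in
-- no tile (i.e. pairwise non-overlapping with union exactly R).
-- "Exactly one" is expressed through a unique index into the list.
open import Data.Fin using (Fin)
open import Data.List using (lookup)

IsTilingOf : (Cell → Set) → List Tile → Set
IsTilingOf R T =
  (∀ (i : Fin (length T)) (c : Cell) → c ∈ cells (lookup T i) → R c) ×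
  (∀ (c : Cell) → R c →
     Σ (Fin (length T)) λ i → (c ∈ cells (lookup T i)) ×
       (∀ (j : Fin (length T)) → c ∈ cells (lookup T j) → j ≡ i))

-- Squares of one residue class modulo 4 are built in concentric layers: a frame
-- of width 2 made of T-tetrominoes turns the tiling of the square of side s into
-- one of side s + 4.  The frame also covers the (at most two) cells that the inner
-- tiling leaves to monominoes and leaves the same pattern of holes in the outer
-- square, so the number of monominoes is that of the innermost square.  A frame
-- consists of single T-tetrominoes and staircases of interlocking T-tetrominoes of
-- length 4(m+1); with all corners written as o + k or o + 4(m+1) + k it is a finite
-- symbolic object.  Writing each indicator function as a signed sum of indicators
-- of lower-left quadrants at its corners, the frame identity becomes an equality of
-- finite multisets of symbolic corners, which is decided by computation.  The
-- innermost squares and the sides 1, 2, 3 and 5 are checked in the same way.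
module Submission where

open import Defs
open import Data.Bool as Bool using (Bool; true; false; T)
open import Data.Fin using (Fin; zero; suc)
open import Data.Integer as ℤ using (ℤ; +_; -[1+_])
open import Data.Integer.Properties using (+-injective)
open import Data.List using (List; []; _∷_; _++_; map; length; lookup)
open import Data.List.Membership.Propositional using (_∈_)
open import Data.List.Properties using (map-++; map-∘; map-cong)
open import Data.List.Relation.Binary.Permutation.Propositional
  using (_↭_; ↭-refl; ↭-prep; ↭-swap; ↭-trans; ↭-sym)
open import Data.List.Relation.Binary.Permutation.Propositional.Properties using (map⁺)
open import Data.List.Relation.Unary.Any using (here; there)
open import Data.Maybe as Maybe using (Maybe; just; nothing)
open import Data.Nat as ℕ using (ℕ; zero; suc; _+_; _*_; _≤_; _<_; _%_; _/_; z≤n; s≤s; s≤s⁻¹)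
open import Data.Nat.DivMod using (m≡m%n+[m/n]*n; m%n<n)
open import Data.Nat.ListAction using (sum)
open import Data.Nat.ListAction.Properties using (sum-++; sum-↭)
open import Data.Nat.Properties
  using (_<?_; <-cmp; <⇒≢; >⇒≢; <⇒≱; <⇒≯; <-irrefl; n<1+n; m<n⇒m<1+n; ≤-trans; m≤m+n; m≤n+m; suc-injective;
         +-comm; +-assoc; +-suc; +-identityʳ; *-zeroʳ; +-cancelʳ-≡; ≤ᵇ⇒≤; +-commutativeSemigroup)
open import Algebra.Properties.CommutativeSemigroup +-commutativeSemigroup
  using (interchange; xy∙z≈xz∙y; x∙yz≈y∙xz)
open import Data.Nat.Tactic.RingSolver using (solve-∀)
open import Data.Product as Product using (Σ; _×_; _,_; proj₁; proj₂)
open import Data.Product.Properties using (≡-dec)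
open import Data.Unit using (tt)
open import Function using (_∘_)
open import Relation.Binary.Definitions using (DecidableEquality; tri<; tri≈; tri>)
open import Relation.Binary.PropositionalEquality
  using (_≡_; refl; sym; trans; cong; cong₂; subst; subst₂; module ≡-Reasoning)
open import Relation.Nullary using (Dec; yes; no; ¬_; contradiction)
open import Relation.Unary using (Decidable)
open ≡-Reasoning

-- Covering multiplicities

𝟙 : ∀ {p} {P : Set p} → Dec P → ℕ
𝟙 (yes _) = 1
𝟙 (no _)  = 0

𝟙-yes : ∀ {p} {P : Set p} (d : Dec P) → P → 𝟙 d ≡ 1
𝟙-yes (yes _) _  = refl
𝟙-yes (no ¬p) p  = contradiction p ¬p

𝟙-no : ∀ {p} {P : Set p} (d : Dec P) → ¬ P → 𝟙 d ≡ 0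
𝟙-no (yes p) ¬p = contradiction p ¬p
𝟙-no (no _) _   = refl

hit : Cell → Cell → ℕ
hit (x , y) (x′ , y′) = 𝟙 (x ℤ.≟ x′) * 𝟙 (y ℤ.≟ y′)

hit-self : ∀ c → hit c c ≡ 1
hit-self (x , y) rewrite 𝟙-yes (x ℤ.≟ x) refl | 𝟙-yes (y ℤ.≟ y) refl = refl

hit-≡ : ∀ c q → 0 < hit c q → c ≡ q
hit-≡ (x , y) (x′ , y′) h with x ℤ.≟ x′ | y ℤ.≟ y′
hit-≡ (x , y) (x , y)   h  | yes refl | yes refl = refl
hit-≡ (x , y) (x′ , y′) () | no _     | _
hit-≡ (x , y) (x′ , y′) () | yes _    | no _

mult : Cell → List Cell → ℕ
mult c []       = 0
mult c (q ∷ qs) = hit c q + mult c qs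

∈⇒mult : ∀ {c qs} → c ∈ qs → 0 < mult c qs
∈⇒mult {c} (here refl) rewrite hit-self c = s≤s z≤n
∈⇒mult {c} {q ∷ qs} (there c∈qs) = ≤-trans (∈⇒mult c∈qs) (m≤n+m (mult c qs) (hit c q))

mult⇒∈ : ∀ {c} qs → 0 < mult c qs → c ∈ qs
mult⇒∈ {c} (q ∷ qs) h with hit c q in eq
... | suc _ = here (hit-≡ c q (subst (0 <_) (sym eq) (s≤s z≤n)))
... | zero  = there (mult⇒∈ qs h)

cover : List Tile → Cell → ℕ
cover []       c = 0
cover (t ∷ ts) c = mult c (cells t) + cover ts c

cover-++ : ∀ ts us c → cover (ts ++ us) c ≡ cover ts c + cover us c
cover-++ []       us c = refl
cover-++ (t ∷ ts) us c = trans (cong (λ n → mult c (cells t) + n) (cover-++ ts us c))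
                               (sym (+-assoc (mult c (cells t)) (cover ts c) (cover us c)))

mult≤cover : ∀ ts c (i : Fin (length ts)) → mult c (cells (lookup ts i)) ≤ cover ts c
mult≤cover (t ∷ ts) c zero    = m≤m+n _ _
mult≤cover (t ∷ ts) c (suc i) = ≤-trans (mult≤cover ts c i) (m≤n+m _ _)

∈⇒cover : ∀ ts c (i : Fin (length ts)) → c ∈ cells (lookup ts i) → 0 < cover ts c
∈⇒cover ts c i c∈t = ≤-trans (∈⇒mult c∈t) (mult≤cover ts c i)

cover≡1⇒unique : ∀ ts c → cover ts c ≡ 1 →
  Σ (Fin (length ts)) λ i → c ∈ cells (lookup ts i) × (∀ j → c ∈ cells (lookup ts j) → j ≡ i)
cover≡1⇒unique (t ∷ ts) c h with mult c (cells t) in eq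
... | zero = let i , c∈i , unique = cover≡1⇒unique ts c h in suc i , c∈i , only-i unique
  where
  only-i : ∀ {i} → (∀ j → c ∈ cells (lookup ts j) → j ≡ i) →
           ∀ j → c ∈ cells (lookup (t ∷ ts) j) → j ≡ suc i
  only-i _      zero    c∈t = contradiction (subst (0 <_) eq (∈⇒mult c∈t)) λ ()
  only-i unique (suc j) c∈j = cong suc (unique j c∈j)
... | suc zero = zero , mult⇒∈ (cells t) (subst (0 <_) (sym eq) (s≤s z≤n)) , only-zero
  where
  only-zero : ∀ j → c ∈ cells (lookup (t ∷ ts) j) → j ≡ zero
  only-zero zero    _   = refl
  only-zero (suc j) c∈j = contradiction (subst (0 <_) (suc-injective h) (∈⇒cover ts c j c∈j)) λ ()
... | suc (suc _) = contradiction (suc-injective h) λ ()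

cover⇒tiling : ∀ {R : Cell → Set} (R? : Decidable R) ts → (∀ c → cover ts c ≡ 𝟙 (R? c)) → IsTilingOf R ts
cover⇒tiling {R} R? ts cover≡R =
  inside , λ c Rc → cover≡1⇒unique ts c (trans (cover≡R c) (𝟙-yes (R? c) Rc))
  where
  inside : ∀ i c → c ∈ cells (lookup ts i) → R c
  inside i c c∈i with R? c | cover≡R c
  ... | yes Rc | _  = Rc
  ... | no _   | eq = contradiction (subst (0 <_) eq (∈⇒cover ts c i c∈i)) λ ()

-- Quadrant expansions

below : ℕ → ℤ → ℕ
below a (+ z)    = 𝟙 (z <? a)
below a -[1+ _ ] = 1

Interval : (ℤ → ℕ) → ℕ → ℕ → Set
Interval e a b = ∀ z → e z + below a z ≡ below b z

Interval-++ : ∀ {e e′ a b c} → Interval e a b → Interval e′ b c → Interval (λ z → e z + e′ z) a c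
Interval-++ {e} {e′} e-ab e′-bc z =
  trans (trans (+-assoc (e z) (e′ z) _) (x∙yz≈y∙xz (e z) (e′ z) _))
        (trans (cong (λ n → e′ z + n) (e-ab z)) (e′-bc z))

point : ℕ → ℤ → ℕ
point x z = 𝟙 (z ℤ.≟ + x)

point-interval : ∀ x → Interval (point x) x (suc x)
point-interval x -[1+ _ ] = refl
point-interval x (+ z) with <-cmp z x
... | tri< z<x _ _ = trans (cong₂ _+_ (𝟙-no (+ z ℤ.≟ + x) (<⇒≢ z<x ∘ +-injective)) (𝟙-yes (z <? x) z<x))
                           (sym (𝟙-yes (z <? suc x) (m<n⇒m<1+n z<x)))
... | tri≈ _ refl _ = trans (cong₂ _+_ (𝟙-yes (+ z ℤ.≟ + z) refl) (𝟙-no (z <? z) (<-irrefl refl)))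
                            (sym (𝟙-yes (z <? suc z) (n<1+n z)))
... | tri> _ _ x<z = trans (cong₂ _+_ (𝟙-no (+ z ℤ.≟ + x) (>⇒≢ x<z ∘ +-injective)) (𝟙-no (z <? x) (<⇒≯ x<z)))
                           (sym (𝟙-no (z <? suc x) (<⇒≱ x<z ∘ s≤s⁻¹)))

run : ℕ → ℕ → ℤ → ℕ
run x zero    z = 0
run x (suc k) z = point x z + run (suc x) k z

run-interval : ∀ x k → Interval (run x k) x (x + k)
run-interval x zero    z = sym (cong (λ b → below b z) (+-identityʳ x))
run-interval x (suc k) = subst (Interval (run x (suc k)) x) (sym (+-suc x k))
  (Interval-++ (point-interval x) (run-interval (suc x) k))

run-++ : ∀ x k l z → run x (k + l) z ≡ run x k z + run (k + x) l z
run-++ x zero    l z = refl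
run-++ x (suc k) l z = trans (cong (λ n → point x z + n) (run-++ (suc x) k l z))
  (trans (sym (+-assoc (point x z) _ _)) (cong (λ y → run x (suc k) z + run y l z) (+-suc k x)))

InRange : ℕ → ℤ → Set
InRange n z = Σ ℕ λ i → i < n × z ≡ + i

inRange? : ∀ n → Decidable (InRange n)
inRange? n (+ i) with i <? n
... | yes i<n = yes (i , i<n , refl)
... | no i≮n  = no λ { (_ , i<n , refl) → i≮n i<n }
inRange? n -[1+ _ ] = no λ { (_ , _ , ()) }

range-interval : ∀ n → Interval (λ z → 𝟙 (inRange? n z)) 0 n
range-interval n -[1+ _ ] = refl
range-interval n (+ i) with i <? n
... | yes _ = refl
... | no _  = refl

inSquare? : ∀ n → Decidable (InSquare n)
inSquare? n (x , y) with inRange? n x | inRange? n y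
... | yes (i , i<n , x≡i) | yes (j , j<n , y≡j) = yes (i , j , i<n , j<n , x≡i , y≡j)
... | no ¬x | _     = no λ { (i , _ , i<n , _ , refl , _) → ¬x (i , i<n , refl) }
... | yes _ | no ¬y = no λ { (_ , j , _ , j<n , _ , refl) → ¬y (j , j<n , refl) }

𝟙-inSquare : ∀ n c → 𝟙 (inSquare? n c) ≡ 𝟙 (inRange? n (proj₁ c)) * 𝟙 (inRange? n (proj₂ c))
𝟙-inSquare n (x , y) with inRange? n x | inRange? n y
... | yes _ | yes _ = refl
... | no _  | _     = refl
... | yes _ | no _  = refl

Point : Set
Point = ℕ × ℕ

quadrant : Point → Cell → ℕ
quadrant (a , b) (x , y) = below a x * below b y

Σq : List Point → Cell → ℕ
Σq ps c = sum (map (λ p → quadrant p c) ps)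

Σq-++ : ∀ ps qs c → Σq (ps ++ qs) c ≡ Σq ps c + Σq qs c
Σq-++ ps qs c = trans (cong sum (map-++ _ ps qs)) (sum-++ (map _ ps) (map _ qs))

Σq-↭ : ∀ {ps qs} → ps ↭ qs → ∀ c → Σq ps c ≡ Σq qs c
Σq-↭ ps↭qs c = sum-↭ (map⁺ _ ps↭qs)

record Corners (P : Set) : Set where
  constructor _─_
  field
    pos neg : List P
open Corners

_⊕_ : ∀ {P} → Corners P → Corners P → Corners P
s ⊕ t = (pos s ++ pos t) ─ (neg s ++ neg t)

mapᶜ : ∀ {P Q} → (P → Q) → Corners P → Corners Q
mapᶜ f s = map f (pos s) ─ map f (neg s)

mapᶜ-⊕ : ∀ {P Q} (f : P → Q) s t → mapᶜ f (s ⊕ t) ≡ mapᶜ f s ⊕ mapᶜ f t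
mapᶜ-⊕ f s t = cong₂ _─_ (map-++ f (pos s) (pos t)) (map-++ f (neg s) (neg t))

box : ∀ {A : Set} → A × A → A × A → Corners (A × A)
box (a , b) (a′ , b′) = ((a′ , b′) ∷ (a , b) ∷ []) ─ ((a′ , b) ∷ (a , b′) ∷ [])

-- f ⊨ s says that f = Σ pos − Σ neg as sums of quadrant indicators, with the
-- negative part moved to the left so that no subtraction occurs.
infix 4 _⊨_
record _⊨_ (f : Cell → ℕ) (s : Corners Point) : Set where
  constructor realise
  field
    at : ∀ c → f c + Σq (neg s) c ≡ Σq (pos s) c
open _⊨_

⊨-cong : ∀ {f g s} → (∀ c → f c ≡ g c) → f ⊨ s → g ⊨ s
⊨-cong f≡g f⊨s = realise λ c → trans (cong (_+ _) (sym (f≡g c))) (at f⊨s c)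

⊨-functional : ∀ {f g s} → f ⊨ s → g ⊨ s → ∀ c → f c ≡ g c
⊨-functional {s = s} f⊨s g⊨s c = +-cancelʳ-≡ (Σq (neg s) c) _ _ (trans (at f⊨s c) (sym (at g⊨s c)))

⊨-⊕ : ∀ {f g s t} → f ⊨ s → g ⊨ t → (λ c → f c + g c) ⊨ s ⊕ t
⊨-⊕ {f} {g} {s} {t} f⊨s g⊨t = realise λ c → begin
  (f c + g c) + Σq (neg s ++ neg t) c         ≡⟨ cong (λ n → (f c + g c) + n) (Σq-++ (neg s) (neg t) c) ⟩
  (f c + g c) + (Σq (neg s) c + Σq (neg t) c) ≡⟨ interchange (f c) (g c) _ _ ⟩
  (f c + Σq (neg s) c) + (g c + Σq (neg t) c) ≡⟨ cong₂ _+_ (at f⊨s c) (at g⊨t c) ⟩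
  Σq (pos s) c + Σq (pos t) c                 ≡⟨ Σq-++ (pos s) (pos t) c ⟨
  Σq (pos s ++ pos t) c                       ∎

⊨-cancel : ∀ {f g s t} → (λ c → f c + g c) ⊨ s ⊕ t → g ⊨ t → f ⊨ s
⊨-cancel {f} {g} {s} {t} fg⊨st g⊨t = realise λ c → +-cancelʳ-≡ (g c + Σq (neg t) c) _ _ (begin
  (f c + Σq (neg s) c) + (g c + Σq (neg t) c) ≡⟨ interchange (f c) _ (g c) _ ⟩
  (f c + g c) + (Σq (neg s) c + Σq (neg t) c) ≡⟨ cong (λ n → (f c + g c) + n) (Σq-++ (neg s) (neg t) c) ⟨
  (f c + g c) + Σq (neg s ++ neg t) c         ≡⟨ at fg⊨st c ⟩
  Σq (pos s ++ pos t) c                       ≡⟨ Σq-++ (pos s) (pos t) c ⟩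
  Σq (pos s) c + Σq (pos t) c                 ≡⟨ cong (λ n → Σq (pos s) c + n) (at g⊨t c) ⟨
  Σq (pos s) c + (g c + Σq (neg t) c)         ∎)

⊨-↭ : ∀ {f s t} → f ⊨ s → pos s ++ neg t ↭ pos t ++ neg s → f ⊨ t
⊨-↭ {f} {s} {t} f⊨s balanced = realise λ c → +-cancelʳ-≡ (Σq (neg s) c) _ _ (begin
  (f c + Σq (neg t) c) + Σq (neg s) c ≡⟨ xy∙z≈xz∙y (f c) _ _ ⟩
  (f c + Σq (neg s) c) + Σq (neg t) c ≡⟨ cong (_+ Σq (neg t) c) (at f⊨s c) ⟩
  Σq (pos s) c + Σq (neg t) c         ≡⟨ Σq-++ (pos s) (neg t) c ⟨
  Σq (pos s ++ neg t) c               ≡⟨ Σq-↭ balanced c ⟩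
  Σq (pos t ++ neg s) c               ≡⟨ Σq-++ (pos t) (neg s) c ⟩
  Σq (pos t) c + Σq (neg s) c         ∎)

product-corners : ∀ e a a′ e′ b b′ → e + a ≡ a′ → e′ + b ≡ b′ →
                  e * e′ + (a′ * b + (a * b′ + 0)) ≡ a′ * b′ + (a * b + 0)
product-corners e a _ e′ b _ refl refl = identity e a e′ b
  where
  identity : ∀ e a e′ b → e * e′ + ((e + a) * b + (a * (e′ + b) + 0)) ≡ (e + a) * (e′ + b) + (a * b + 0)
  identity = solve-∀

⊨-box : ∀ {e e′ a a′ b b′} → Interval e a a′ → Interval e′ b b′ →
        (λ c → e (proj₁ c) * e′ (proj₂ c)) ⊨ box (a , b) (a′ , b′)
⊨-box {e} {e′} {a} {a′} {b} {b′} ex e′y = realise λ (x , y) →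
  product-corners (e x) (below a x) (below a′ x) (e′ y) (below b y) (below b′ y) (ex x) (e′y y)

-- T-tetrominoes and staircases

embed : Point → Cell
embed (x , y) = (+ x , + y)

cellBoxes : ∀ {A : Set} → (A → A) → List (A × A) → Corners (A × A)
cellBoxes next []             = [] ─ []
cellBoxes next ((x , y) ∷ ps) = box (x , y) (next x , next y) ⊕ cellBoxes next ps

mult-embed : ∀ ps → (λ c → mult c (map embed ps)) ⊨ cellBoxes suc ps
mult-embed []             = realise λ c → refl
mult-embed ((x , y) ∷ ps) = ⊨-⊕ (⊨-box (point-interval x) (point-interval y)) (mult-embed ps)

-- Unlike tee in Defs, teeAt places a T-tetromino by the lower-left corner of its
-- bounding box; footprint lists its cells in the order of cells.
footprint : ∀ {A : Set} → (A → A) → Dir → A × A → List (A × A)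
footprint s up    (x , y) = (s x , y) ∷ (x , y) ∷ (s (s x) , y) ∷ (s x , s y) ∷ []
footprint s down  (x , y) = (s x , s y) ∷ (x , s y) ∷ (s (s x) , s y) ∷ (s x , y) ∷ []
footprint s left  (x , y) = (s x , s y) ∷ (s x , s (s y)) ∷ (s x , y) ∷ (x , s y) ∷ []
footprint s right (x , y) = (x , s y) ∷ (x , s (s y)) ∷ (x , y) ∷ (s x , s y) ∷ []

teeAt : Dir → Point → Tile
teeAt up    (x , y) = tee (+ suc x , + y) up
teeAt down  (x , y) = tee (+ suc x , + suc y) down
teeAt left  (x , y) = tee (+ suc x , + suc y) left
teeAt right (x , y) = tee (+ x , + suc y) right

cells-teeAt : ∀ d p → cells (teeAt d p) ≡ map embed (footprint suc d p)
cells-teeAt up    (x , y) rewrite +-comm (suc x) 1 | +-comm y 1 = refl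
cells-teeAt down  (x , y) rewrite +-comm (suc x) 1 = refl
cells-teeAt left  (x , y) rewrite +-comm (suc y) 1 = refl
cells-teeAt right (x , y) rewrite +-comm (suc y) 1 | +-comm x 1 = refl

cover-teeAt : ∀ d p c → cover (teeAt d p ∷ []) c ≡ mult c (map embed (footprint suc d p))
cover-teeAt d p c = trans (+-identityʳ _) (cong (mult c) (cells-teeAt d p))

cover-pair : ∀ d p d′ p′ c → cover (teeAt d p ∷ teeAt d′ p′ ∷ []) c
           ≡ mult c (map embed (footprint suc d p)) + (mult c (map embed (footprint suc d′ p′)) + 0)
cover-pair d p d′ p′ c = cong₂ (λ u v → mult c u + (mult c v + 0)) (cells-teeAt d p) (cells-teeAt d′ p′)

-- A period of a staircase: two interlocking T-tetrominoes covering four consecutive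
-- cells of one line and the four cells shifted by one of the next line.  For a
-- rising staircase the lower (resp. left) line is the unshifted one.
data Slant : Set where
  rising falling : Slant

rows : ∀ {A : Set} → (A → A) → Slant → A → A × A
rows next rising  y = y , next y
rows next falling y = next y , y

hPeriod : Slant → Point → List Tile
hPeriod rising  (x , y) = teeAt up (x , y) ∷ teeAt down (2 + x , y) ∷ []
hPeriod falling (x , y) = teeAt down (x , y) ∷ teeAt up (2 + x , y) ∷ []

vPeriod : Slant → Point → List Tile
vPeriod rising  (x , y) = teeAt right (x , y) ∷ teeAt left (x , 2 + y) ∷ []
vPeriod falling (x , y) = teeAt left (x , y) ∷ teeAt right (x , 2 + y) ∷ []

hStairs : Slant → Point → ℕ → List Tile
hStairs s p       zero    = []
hStairs s (x , y) (suc n) = hPeriod s (x , y) ++ hStairs s (4 + x , y) n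

vStairs : Slant → Point → ℕ → List Tile
vStairs s p       zero    = []
vStairs s (x , y) (suc n) = vPeriod s (x , y) ++ vStairs s (x , 4 + y) n

hRuns : ℕ → ℕ → ℕ × ℕ → Cell → ℕ
hRuns x k (r₁ , r₂) (X , Y) = run x k X * point r₁ Y + run (suc x) k X * point r₂ Y

vRuns : ℕ × ℕ → ℕ → ℕ → Cell → ℕ
vRuns (c₁ , c₂) y k (X , Y) = point c₁ X * run y k Y + point c₂ X * run (suc y) k Y

hPeriod-algebra : ∀ h₀ h₁ h₂ h₃ h₄ v₁ v₂ →
  (h₁ * v₁ + (h₀ * v₁ + (h₂ * v₁ + (h₁ * v₂ + 0)))) + ((h₃ * v₂ + (h₂ * v₂ + (h₄ * v₂ + (h₃ * v₁ + 0)))) + 0)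
  ≡ (h₀ + (h₁ + (h₂ + (h₃ + 0)))) * v₁ + (h₁ + (h₂ + (h₃ + (h₄ + 0)))) * v₂
hPeriod-algebra = solve-∀

vPeriod-algebra : ∀ u₁ u₂ w₀ w₁ w₂ w₃ w₄ →
  (u₁ * w₁ + (u₁ * w₂ + (u₁ * w₀ + (u₂ * w₁ + 0)))) + ((u₂ * w₃ + (u₂ * w₄ + (u₂ * w₂ + (u₁ * w₃ + 0)))) + 0)
  ≡ u₁ * (w₀ + (w₁ + (w₂ + (w₃ + 0)))) + u₂ * (w₁ + (w₂ + (w₃ + (w₄ + 0))))
vPeriod-algebra = solve-∀

hPeriod-cover : ∀ s x y c → cover (hPeriod s (x , y)) c ≡ hRuns x 4 (rows suc s y) c
hPeriod-cover rising x y (X , Y) = trans (cover-pair up (x , y) down (2 + x , y) (X , Y))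
  (hPeriod-algebra (point x X) (point (1 + x) X) (point (2 + x) X) (point (3 + x) X) (point (4 + x) X)
                   (point y Y) (point (suc y) Y))
hPeriod-cover falling x y (X , Y) = trans (cover-pair down (x , y) up (2 + x , y) (X , Y))
  (hPeriod-algebra (point x X) (point (1 + x) X) (point (2 + x) X) (point (3 + x) X) (point (4 + x) X)
                   (point (suc y) Y) (point y Y))

vPeriod-cover : ∀ s x y c → cover (vPeriod s (x , y)) c ≡ vRuns (rows suc s x) y 4 c
vPeriod-cover rising x y (X , Y) = trans (cover-pair right (x , y) left (x , 2 + y) (X , Y))
  (vPeriod-algebra (point x X) (point (suc x) X)
                   (point y Y) (point (1 + y) Y) (point (2 + y) Y) (point (3 + y) Y) (point (4 + y) Y))
vPeriod-cover falling x y (X , Y) = trans (cover-pair left (x , y) right (x , 2 + y) (X , Y))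
  (vPeriod-algebra (point (suc x) X) (point x X)
                   (point y Y) (point (1 + y) Y) (point (2 + y) Y) (point (3 + y) Y) (point (4 + y) Y))

regroupʳ : ∀ a b c d v w → (a * v + b * w) + (c * v + d * w) ≡ (a + c) * v + (b + d) * w
regroupʳ = solve-∀

regroupˡ : ∀ a b c d v w → (v * a + w * b) + (v * c + w * d) ≡ v * (a + c) + w * (b + d)
regroupˡ = solve-∀

hStairs-cover : ∀ s x y n c → cover (hStairs s (x , y) n) c ≡ hRuns x (n * 4) (rows suc s y) c
hStairs-cover s x y zero    c       = refl
hStairs-cover s x y (suc n) (X , Y) = begin
  cover (hPeriod s (x , y) ++ hStairs s (4 + x , y) n) (X , Y)
    ≡⟨ cover-++ (hPeriod s (x , y)) _ (X , Y) ⟩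
  cover (hPeriod s (x , y)) (X , Y) + cover (hStairs s (4 + x , y) n) (X , Y)
    ≡⟨ cong₂ _+_ (hPeriod-cover s x y (X , Y)) (hStairs-cover s (4 + x) y n (X , Y)) ⟩
  (run x 4 X * v₁ + run (suc x) 4 X * v₂) + (run (4 + x) (n * 4) X * v₁ + run (5 + x) (n * 4) X * v₂)
    ≡⟨ regroupʳ (run x 4 X) (run (suc x) 4 X) (run (4 + x) (n * 4) X) (run (5 + x) (n * 4) X) v₁ v₂ ⟩
  (run x 4 X + run (4 + x) (n * 4) X) * v₁ + (run (suc x) 4 X + run (5 + x) (n * 4) X) * v₂
    ≡⟨ cong₂ (λ a b → a * v₁ + b * v₂) (run-++ x 4 (n * 4) X) (run-++ (suc x) 4 (n * 4) X) ⟨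
  run x (suc n * 4) X * v₁ + run (suc x) (suc n * 4) X * v₂ ∎
  where
  v₁ = point (proj₁ (rows suc s y)) Y
  v₂ = point (proj₂ (rows suc s y)) Y

vStairs-cover : ∀ s x y n c → cover (vStairs s (x , y) n) c ≡ vRuns (rows suc s x) y (n * 4) c
vStairs-cover s x y zero    (X , Y) = sym (cong₂ _+_ (*-zeroʳ (point _ X)) (*-zeroʳ (point _ X)))
vStairs-cover s x y (suc n) (X , Y) = begin
  cover (vPeriod s (x , y) ++ vStairs s (x , 4 + y) n) (X , Y)
    ≡⟨ cover-++ (vPeriod s (x , y)) _ (X , Y) ⟩
  cover (vPeriod s (x , y)) (X , Y) + cover (vStairs s (x , 4 + y) n) (X , Y)
    ≡⟨ cong₂ _+_ (vPeriod-cover s x y (X , Y)) (vStairs-cover s x (4 + y) n (X , Y)) ⟩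
  (u₁ * run y 4 Y + u₂ * run (suc y) 4 Y) + (u₁ * run (4 + y) (n * 4) Y + u₂ * run (5 + y) (n * 4) Y)
    ≡⟨ regroupˡ (run y 4 Y) (run (suc y) 4 Y) (run (4 + y) (n * 4) Y) (run (5 + y) (n * 4) Y) u₁ u₂ ⟩
  u₁ * (run y 4 Y + run (4 + y) (n * 4) Y) + u₂ * (run (suc y) 4 Y + run (5 + y) (n * 4) Y)
    ≡⟨ cong₂ (λ a b → u₁ * a + u₂ * b) (run-++ y 4 (n * 4) Y) (run-++ (suc y) 4 (n * 4) Y) ⟨
  u₁ * run y (suc n * 4) Y + u₂ * run (suc y) (suc n * 4) Y ∎
  where
  u₁ = point (proj₁ (rows suc s x)) X
  u₂ = point (proj₂ (rows suc s x)) X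

numMono-++ : ∀ ts us → numMono (ts ++ us) ≡ numMono ts + numMono us
numMono-++ []            us = refl
numMono-++ (mono _ ∷ ts) us = cong suc (numMono-++ ts us)
numMono-++ (tee _ _ ∷ ts) us = numMono-++ ts us

numMono-teeAt : ∀ d p ts → numMono (teeAt d p ∷ ts) ≡ numMono ts
numMono-teeAt up    p ts = refl
numMono-teeAt down  p ts = refl
numMono-teeAt left  p ts = refl
numMono-teeAt right p ts = refl

numMono-hStairs : ∀ s p n → numMono (hStairs s p n) ≡ 0
numMono-hStairs s       p       zero    = refl
numMono-hStairs rising  (x , y) (suc n) = numMono-hStairs rising (4 + x , y) n
numMono-hStairs falling (x , y) (suc n) = numMono-hStairs falling (4 + x , y) n

numMono-vStairs : ∀ s p n → numMono (vStairs s p n) ≡ 0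
numMono-vStairs s       p       zero    = refl
numMono-vStairs rising  (x , y) (suc n) = numMono-vStairs rising (x , 4 + y) n
numMono-vStairs falling (x , y) (suc n) = numMono-vStairs falling (x , 4 + y) n

-- Multiset equality

module _ {A : Set} (_≟_ : DecidableEquality A) where

  remove : A → List A → Maybe (List A)
  remove x []       = nothing
  remove x (y ∷ ys) with x ≟ y
  ... | yes _ = just ys
  ... | no _  = Maybe.map (y ∷_) (remove x ys)

  sameBag : List A → List A → Bool
  sameBag []       []      = true
  sameBag []       (_ ∷ _) = false
  sameBag (x ∷ xs) ys with remove x ys
  ... | just ys′ = sameBag xs ys′
  ... | nothing  = false

  remove-↭ : ∀ x ys {zs} → remove x ys ≡ just zs → ys ↭ x ∷ zs
  remove-↭ x (y ∷ ys) eq with x ≟ y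
  remove-↭ x (x ∷ ys) refl | yes refl = ↭-refl
  ... | no _ with remove x ys in removed
  remove-↭ x (y ∷ ys) refl | no _ | just ws =
    ↭-trans (↭-prep y (remove-↭ x ys removed)) (↭-swap y x ↭-refl)

  sameBag-↭ : ∀ xs ys → T (sameBag xs ys) → xs ↭ ys
  sameBag-↭ []       []   _ = ↭-refl
  sameBag-↭ (x ∷ xs) ys same with remove x ys in removed
  ... | just ys′ = ↭-trans (↭-prep x (sameBag-↭ xs ys′ same)) (↭-sym (remove-↭ x ys removed))

-- Symbolic coordinates and pieces

-- At offset o and level m, lo k stands for o + k and hi k for o + 4(m + 1) + k.
record Coord : Set where
  constructor coord
  field
    offset : ℕ
    far    : Bool
open Coord

lo hi : ℕ → Coord
lo k = coord k false
hi k = coord k true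

next : Coord → Coord
next a = coord (suc (offset a)) (far a)

origin : ℕ → ℕ → Bool → ℕ
origin o m false = o
origin o m true  = o + suc m * 4

place : ℕ → ℕ → Coord → ℕ
place o m a = offset a + origin o m (far a)

_≟ᶜ_ : DecidableEquality Coord
coord k f ≟ᶜ coord k′ f′ with k ℕ.≟ k′ | f Bool.≟ f′
... | yes refl | yes refl = yes refl
... | no k≢k′  | _        = no λ { refl → k≢k′ refl }
... | yes _    | no f≢f′  = no λ { refl → f≢f′ refl }

SPoint : Set
SPoint = Coord × Coord

onBoth : (Coord → Coord) → SPoint → SPoint
onBoth g = Product.map g g

placeᵖ : ℕ → ℕ → SPoint → Point
placeᵖ o m = Product.map (place o m) (place o m)

balanced : Corners SPoint → Corners SPoint → Bool
balanced s t = sameBag (≡-dec _≟ᶜ_ _≟ᶜ_) (pos s ++ neg t) (pos t ++ neg s)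

infix 4 _⊨⟨_,_⟩_
_⊨⟨_,_⟩_ : (Cell → ℕ) → ℕ → ℕ → Corners SPoint → Set
f ⊨⟨ o , m ⟩ s = f ⊨ mapᶜ (placeᵖ o m) s

⊨-balanced : ∀ {f o m s t} → f ⊨⟨ o , m ⟩ s → T (balanced s t) → f ⊨⟨ o , m ⟩ t
⊨-balanced {o = o} {m} {s} {t} f⊨s same = ⊨-↭ f⊨s
  (subst₂ _↭_ (map-++ (placeᵖ o m) (pos s) (neg t)) (map-++ (placeᵖ o m) (pos t) (neg s))
    (map⁺ (placeᵖ o m) (sameBag-↭ _ _ _ same)))

⊨ˢ-⊕ : ∀ {f g o m s t} → f ⊨⟨ o , m ⟩ s → g ⊨⟨ o , m ⟩ t → (λ c → f c + g c) ⊨⟨ o , m ⟩ s ⊕ t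
⊨ˢ-⊕ {o = o} {m} {s} {t} f⊨s g⊨t = subst (_ ⊨_) (sym (mapᶜ-⊕ (placeᵖ o m) s t)) (⊨-⊕ f⊨s g⊨t)

⊨ˢ-cancel : ∀ {f g o m s t} → (λ c → f c + g c) ⊨⟨ o , m ⟩ s ⊕ t → g ⊨⟨ o , m ⟩ t → f ⊨⟨ o , m ⟩ s
⊨ˢ-cancel {o = o} {m} {s} {t} fg⊨st g⊨t =
  ⊨-cancel (subst (_ ⊨_) (mapᶜ-⊕ (placeᵖ o m) s t) fg⊨st) g⊨t

reindex : ∀ {o m o′ m′} (g : Coord → Coord) → (∀ a → place o m (g a) ≡ place o′ m′ a) →
          ∀ s → mapᶜ (placeᵖ o m) (mapᶜ (onBoth g) s) ≡ mapᶜ (placeᵖ o′ m′) s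
reindex {o} {m} {o′} {m′} g place∘g s = cong₂ _─_ (moved (pos s)) (moved (neg s))
  where
  moved : ∀ ps → map (placeᵖ o m) (map (onBoth g) ps) ≡ map (placeᵖ o′ m′) ps
  moved ps = trans (sym (map-∘ ps)) (map-cong (λ (a , b) → cong₂ _,_ (place∘g a) (place∘g b)) ps)

⊨-reindex : ∀ {f o m o′ m′} (g : Coord → Coord) → (∀ a → place o m (g a) ≡ place o′ m′ a) →
            ∀ s → f ⊨⟨ o′ , m′ ⟩ s → f ⊨⟨ o , m ⟩ mapᶜ (onBoth g) s
⊨-reindex {f} g place∘g s = subst (f ⊨_) (sym (reindex g place∘g s))

⊨-unindex : ∀ {f o m o′ m′} (g : Coord → Coord) → (∀ a → place o m (g a) ≡ place o′ m′ a) →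
            ∀ s → f ⊨⟨ o , m ⟩ mapᶜ (onBoth g) s → f ⊨⟨ o′ , m′ ⟩ s
⊨-unindex {f} g place∘g s = subst (f ⊨_) (reindex g place∘g s)

grow : Coord → Coord
grow (coord k false) = lo k
grow (coord k true)  = hi (4 + k)

inset : Coord → Coord
inset a = coord (2 + offset a) (far a)

flatten : Coord → Coord
flatten (coord k false) = lo k
flatten (coord k true)  = lo (4 + k)

place-grow : ∀ o m a → place o m (grow a) ≡ place o (suc m) a
place-grow o m (coord k false) = refl
place-grow o m (coord k true)  = identity k o m
  where
  identity : ∀ k o m → 4 + k + (o + suc m * 4) ≡ k + (o + suc (suc m) * 4)
  identity = solve-∀

place-inset : ∀ o m a → place o m (inset a) ≡ place (2 + o) m a
place-inset o m (coord k false) = identity k o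
  where
  identity : ∀ k o → 2 + k + o ≡ k + (2 + o)
  identity = solve-∀
place-inset o m (coord k true) = identity k o m
  where
  identity : ∀ k o m → 2 + k + (o + suc m * 4) ≡ k + (2 + o + suc m * 4)
  identity = solve-∀

place-flatten : ∀ o a → place o 0 (flatten a) ≡ place o 0 a
place-flatten o (coord k false) = refl
place-flatten o (coord k true)  = identity k o
  where
  identity : ∀ k o → 4 + k + o ≡ k + (o + 4)
  identity = solve-∀

-- hstairs s k b is a staircase on the rows b and next b running from lo k to hi k,
-- i.e. over 4(m + 1) cells; vstairs s a k is the same on the columns a and next a.
data Piece : Set where
  mon     : SPoint → Piece
  tet     : Dir → SPoint → Piece
  hstairs : Slant → ℕ → Coord → Piece
  vstairs : Slant → Coord → ℕ → Piece

tiles : ℕ → ℕ → Piece → List Tile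
tiles o m (mon p)         = mono (embed (placeᵖ o m p)) ∷ []
tiles o m (tet d p)       = teeAt d (placeᵖ o m p) ∷ []
tiles o m (hstairs s k b) = hStairs s (k + o , place o m b) (suc m)
tiles o m (vstairs s a k) = vStairs s (place o m a , k + o) (suc m)

corners : Piece → Corners SPoint
corners (mon p)         = cellBoxes next (p ∷ [])
corners (tet d p)       = cellBoxes next (footprint next d p)
corners (hstairs s k b) = runs (rows next s b)
  where
  runs : Coord × Coord → Corners SPoint
  runs (r₁ , r₂) = box (lo k , r₁) (hi k , next r₁) ⊕ box (lo (suc k) , r₂) (hi (suc k) , next r₂)
corners (vstairs s a k) = runs (rows next s a)
  where
  runs : Coord × Coord → Corners SPoint
  runs (c₁ , c₂) = box (c₁ , lo k) (next c₁ , hi k) ⊕ box (c₂ , lo (suc k)) (next c₂ , hi (suc k))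

run-lo-hi : ∀ o m k → Interval (run (k + o) (suc m * 4)) (place o m (lo k)) (place o m (hi k))
run-lo-hi o m k = subst (Interval _ (k + o)) (+-assoc k o (suc m * 4))
                        (run-interval (k + o) (suc m * 4))

tiles-corners : ∀ o m p → cover (tiles o m p) ⊨⟨ o , m ⟩ corners p
tiles-corners o m (mon p) = ⊨-cong (λ c → sym (+-identityʳ _)) (mult-embed (placeᵖ o m p ∷ []))
tiles-corners o m (tet d p) = ⊨-cong (λ c → sym (cover-teeAt d (placeᵖ o m p) c)) (footprint-corners d)
  where
  footprint-corners : ∀ d → (λ c → mult c (map embed (footprint suc d (placeᵖ o m p))))
                            ⊨⟨ o , m ⟩ cellBoxes next (footprint next d p)
  footprint-corners up    = mult-embed (footprint suc up (placeᵖ o m p))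
  footprint-corners down  = mult-embed (footprint suc down (placeᵖ o m p))
  footprint-corners left  = mult-embed (footprint suc left (placeᵖ o m p))
  footprint-corners right = mult-embed (footprint suc right (placeᵖ o m p))
tiles-corners o m (hstairs rising k b) =
  ⊨-cong (λ c → sym (hStairs-cover rising (k + o) (place o m b) (suc m) c))
    (⊨-⊕ (⊨-box (run-lo-hi o m k) (point-interval _)) (⊨-box (run-lo-hi o m (suc k)) (point-interval _)))
tiles-corners o m (hstairs falling k b) =
  ⊨-cong (λ c → sym (hStairs-cover falling (k + o) (place o m b) (suc m) c))
    (⊨-⊕ (⊨-box (run-lo-hi o m k) (point-interval _)) (⊨-box (run-lo-hi o m (suc k)) (point-interval _)))
tiles-corners o m (vstairs rising a k) =
  ⊨-cong (λ c → sym (vStairs-cover rising (place o m a) (k + o) (suc m) c))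
    (⊨-⊕ (⊨-box (point-interval _) (run-lo-hi o m k)) (⊨-box (point-interval _) (run-lo-hi o m (suc k))))
tiles-corners o m (vstairs falling a k) =
  ⊨-cong (λ c → sym (vStairs-cover falling (place o m a) (k + o) (suc m) c))
    (⊨-⊕ (⊨-box (point-interval _) (run-lo-hi o m k)) (⊨-box (point-interval _) (run-lo-hi o m (suc k))))

layout : ℕ → ℕ → List Piece → List Tile
layout o m []       = []
layout o m (p ∷ ps) = tiles o m p ++ layout o m ps

cornersAll : List Piece → Corners SPoint
cornersAll []       = [] ─ []
cornersAll (p ∷ ps) = corners p ⊕ cornersAll ps

layout-corners : ∀ o m ps → cover (layout o m ps) ⊨⟨ o , m ⟩ cornersAll ps
layout-corners o m []       = realise λ c → refl
layout-corners o m (p ∷ ps) = ⊨-cong (λ c → sym (cover-++ (tiles o m p) (layout o m ps) c))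
  (⊨ˢ-⊕ (tiles-corners o m p) (layout-corners o m ps))

monoCount : List Piece → ℕ
monoCount []                   = 0
monoCount (mon _ ∷ ps)         = suc (monoCount ps)
monoCount (tet _ _ ∷ ps)       = monoCount ps
monoCount (hstairs _ _ _ ∷ ps) = monoCount ps
monoCount (vstairs _ _ _ ∷ ps) = monoCount ps

numMono-layout : ∀ o m ps → numMono (layout o m ps) ≡ monoCount ps
numMono-layout o m []                   = refl
numMono-layout o m (mon p ∷ ps)         = cong suc (numMono-layout o m ps)
numMono-layout o m (tet d p ∷ ps)       = trans (numMono-teeAt d _ (layout o m ps)) (numMono-layout o m ps)
numMono-layout o m (hstairs s k b ∷ ps) = trans (numMono-++ (hStairs s _ (suc m)) (layout o m ps))
  (cong₂ _+_ (numMono-hStairs s _ (suc m)) (numMono-layout o m ps))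
numMono-layout o m (vstairs s a k ∷ ps) = trans (numMono-++ (vStairs s _ (suc m)) (layout o m ps))
  (cong₂ _+_ (numMono-vStairs s _ (suc m)) (numMono-layout o m ps))

Tiled : ℕ → Set
Tiled n = Σ (List Tile) λ ts → IsTilingOf (InSquare n) ts × numMono ts ≤ 5

square-tiled : ∀ n ts → cover ts ⊨ box (0 , 0) (n , n) → numMono ts ≤ 5 → Tiled n
square-tiled n ts cover⊨ few = ts , cover⇒tiling (inSquare? n) ts covered-once , few
  where
  inSquare⊨ : (λ c → 𝟙 (inSquare? n c)) ⊨ box (0 , 0) (n , n)
  inSquare⊨ = ⊨-cong (λ c → sym (𝟙-inSquare n c)) (⊨-box (range-interval n) (range-interval n))
  covered-once : ∀ c → cover ts c ≡ 𝟙 (inSquare? n c)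
  covered-once = ⊨-functional cover⊨ inSquare⊨

fixed-tiled : ∀ n ps → T (balanced (cornersAll ps) (box (lo 0 , lo 0) (lo n , lo n))) → monoCount ps ≤ 5 →
              Tiled n
fixed-tiled n ps fits few = square-tiled n (layout 0 0 ps)
  (subst (λ k → cover (layout 0 0 ps) ⊨ box (0 , 0) (k , k)) (+-identityʳ n)
         (⊨-balanced (layout-corners 0 0 ps) fits))
  (subst (_≤ 5) (sym (numMono-layout 0 0 ps)) few)

square : ℕ → Corners SPoint
square side = box (lo 0 , lo 0) (hi side , hi side)

-- core tiles the square of level 0 except for the holes; ring is the frame between
-- the square of level m at offset o + 2 and that of level m + 1 at offset o, which
-- must also cover the holes of the inner square.
record Family : Set where
  field
    side  : ℕ
    core  : List Piece
    ring  : List Piece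
    holes : List SPoint
    core-fits : T (balanced (mapᶜ (onBoth flatten) (cornersAll core ⊕ cornersAll (map mon holes)))
                            (mapᶜ (onBoth flatten) (square side)))
    ring-fits : T (balanced (cornersAll ring ⊕ (mapᶜ (onBoth grow) (cornersAll (map mon holes))
                                              ⊕ mapᶜ (onBoth inset) (square side)))
                            (mapᶜ (onBoth grow) (square side) ⊕ mapᶜ (onBoth inset) (cornersAll (map mon holes))))
    ring-tees : monoCount ring ≡ 0
    few-monos : monoCount core + length holes ≤ 5

module _ (F : Family) where
  open Family F

  gaps : List Piece
  gaps = map mon holes

  levels : ℕ → ℕ → List Tile
  levels o zero    = layout o 0 core
  levels o (suc m) = layout o m ring ++ levels (2 + o) m

  levels-fill : ∀ m o → (λ c → cover (levels o m) c + cover (layout o m gaps) c) ⊨⟨ o , m ⟩ square side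
  levels-fill zero o =
    ⊨-unindex flatten (place-flatten o) (square side)
      (⊨-balanced (⊨-reindex flatten (place-flatten o) (cornersAll core ⊕ cornersAll gaps)
                    (⊨ˢ-⊕ (layout-corners o 0 core) (layout-corners o 0 gaps)))
                  core-fits)
  levels-fill (suc m) o =
    ⊨-cong (λ c → cong (_+ outerGaps c) (sym (cover-++ (layout o m ring) (levels (2 + o) m) c)))
      (⊨-unindex grow (place-grow o m) (square side)
        (⊨ˢ-cancel {s = mapᶜ (onBoth grow) (square side)}
          (⊨-balanced (⊨-cong (λ c → shuffle (frame c) (outerGaps c) (inner c) (innerGaps c)) everything)
                      ring-fits)
          innerGaps⊨))
    where
    frame outerGaps inner innerGaps : Cell → ℕ
    frame     = cover (layout o m ring)
    outerGaps = cover (layout o (suc m) gaps)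
    inner     = cover (levels (2 + o) m)
    innerGaps = cover (layout (2 + o) m gaps)
    shuffle : ∀ a b c d → a + (b + (c + d)) ≡ ((a + c) + b) + d
    shuffle = solve-∀
    innerGaps⊨ : innerGaps ⊨⟨ o , m ⟩ mapᶜ (onBoth inset) (cornersAll gaps)
    innerGaps⊨ = ⊨-reindex inset (place-inset o m) (cornersAll gaps) (layout-corners (2 + o) m gaps)
    everything : (λ c → frame c + (outerGaps c + (inner c + innerGaps c)))
                 ⊨⟨ o , m ⟩ cornersAll ring ⊕ (mapᶜ (onBoth grow) (cornersAll gaps)
                                               ⊕ mapᶜ (onBoth inset) (square side))
    everything = ⊨ˢ-⊕ (layout-corners o m ring)
      (⊨ˢ-⊕ (⊨-reindex grow (place-grow o m) (cornersAll gaps) (layout-corners o (suc m) gaps))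
            (⊨-reindex inset (place-inset o m) (square side) (levels-fill m (2 + o))))

  numMono-levels : ∀ m o → numMono (levels o m) ≡ monoCount core
  numMono-levels zero    o = numMono-layout o 0 core
  numMono-levels (suc m) o = trans (numMono-++ (layout o m ring) (levels (2 + o) m))
    (cong₂ _+_ (trans (numMono-layout o m ring) ring-tees) (numMono-levels m (2 + o)))

  monoCount-gaps : monoCount gaps ≡ length holes
  monoCount-gaps = count holes
    where
    count : ∀ hs → monoCount (map mon hs) ≡ length hs
    count []       = refl
    count (h ∷ hs) = cong suc (count hs)

  family-tiled : ∀ m → Tiled (side + suc m * 4)
  family-tiled m = square-tiled _ (levels 0 m ++ layout 0 m gaps)
    (⊨-cong (λ c → sym (cover-++ (levels 0 m) (layout 0 m gaps) c)) (levels-fill m 0))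
    (subst (_≤ 5) (sym (trans (numMono-++ (levels 0 m) (layout 0 m gaps))
                              (cong₂ _+_ (numMono-levels m 0) (trans (numMono-layout 0 m gaps) monoCount-gaps))))
           few-monos)

family₀ : Family
family₀ = record
  { side  = 0
  ; core  = tet right (lo 0 , lo 0) ∷ tet up (lo 1 , lo 0) ∷ tet left (lo 2 , lo 1) ∷ tet down (lo 0 , lo 2)
          ∷ []
  ; ring  = tet right (lo 0 , lo 0) ∷ hstairs rising 1 (lo 0) ∷ tet up (hi 1 , lo 0)
          ∷ hstairs falling 0 (hi 2) ∷ tet down (hi 0 , hi 2)
          ∷ vstairs falling (lo 0) 2
          ∷ vstairs falling (hi 2) 1 ∷ tet left (hi 2 , hi 1) ∷ []
  ; holes = []
  ; core-fits = tt
  ; ring-fits = tt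
  ; ring-tees = refl
  ; few-monos = ≤ᵇ⇒≤ _ 5 tt
  }
family₁ : Family
family₁ = record
  { side  = 5
  ; core  = tet right (lo 0 , lo 0) ∷ tet up (lo 1 , lo 0) ∷ tet down (lo 3 , lo 0) ∷ tet up (lo 5 , lo 0)
          ∷ tet left (lo 7 , lo 0) ∷ tet up (lo 1 , lo 2) ∷ tet up (lo 4 , lo 2) ∷ tet down (lo 6 , lo 2)
          ∷ tet right (lo 0 , lo 3) ∷ mon (lo 1 , lo 3) ∷ tet down (lo 2 , lo 3) ∷ mon (lo 4 , lo 3)
          ∷ tet up (lo 5 , lo 4) ∷ tet left (lo 7 , lo 4)
          ∷ tet down (lo 0 , lo 5) ∷ tet up (lo 2 , lo 5) ∷ tet down (lo 4 , lo 5) ∷ tet right (lo 7 , lo 6)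
          ∷ tet up (lo 0 , lo 7) ∷ tet down (lo 2 , lo 7) ∷ tet up (lo 4 , lo 7) ∷ mon (lo 6 , lo 8) ∷ []
  ; ring  = tet right (lo 0 , lo 0) ∷ hstairs rising 1 (lo 0)
          ∷ tet up (hi 1 , lo 0) ∷ tet down (hi 3 , lo 0) ∷ tet up (hi 5 , lo 0) ∷ tet left (hi 7 , lo 0)
          ∷ tet right (lo 2 , hi 6) ∷ tet down (lo 3 , hi 7) ∷ hstairs rising 5 (hi 7) ∷ tet left (hi 5 , hi 6)
          ∷ vstairs falling (lo 0) 2
          ∷ tet left (lo 0 , hi 2) ∷ tet right (lo 0 , hi 4) ∷ tet left (lo 0 , hi 6)
          ∷ vstairs rising (hi 7) 2
          ∷ tet right (hi 7 , hi 2) ∷ tet left (hi 7 , hi 4) ∷ tet right (hi 7 , hi 6) ∷ []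
  ; holes = (lo 0 , hi 4) ∷ (hi 4 , hi 4) ∷ []
  ; core-fits = tt
  ; ring-fits = tt
  ; ring-tees = refl
  ; few-monos = ≤ᵇ⇒≤ _ 5 tt
  }

family₂ : Family
family₂ = record
  { side  = 2
  ; core  = tet right (lo 0 , lo 0) ∷ tet up (lo 1 , lo 0) ∷ tet down (lo 3 , lo 0)
          ∷ tet down (lo 0 , lo 2) ∷ tet up (lo 2 , lo 2) ∷ tet left (lo 4 , lo 2)
          ∷ tet up (lo 0 , lo 4) ∷ tet down (lo 2 , lo 4) ∷ mon (lo 4 , lo 4) ∷ mon (lo 5 , lo 5) ∷ []
  ; ring  = tet right (lo 0 , lo 0) ∷ hstairs rising 1 (lo 0) ∷ tet up (hi 1 , lo 0) ∷ tet down (hi 3 , lo 0)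
          ∷ hstairs falling 2 (hi 4) ∷ tet down (hi 2 , hi 4)
          ∷ vstairs falling (lo 0) 2 ∷ tet down (lo 0 , hi 2) ∷ tet up (lo 0 , hi 4)
          ∷ tet up (hi 3 , lo 2) ∷ vstairs falling (hi 4) 3 ∷ tet left (hi 4 , hi 3) ∷ []
  ; holes = (hi 1 , lo 0) ∷ (lo 0 , hi 1) ∷ []
  ; core-fits = tt
  ; ring-fits = tt
  ; ring-tees = refl
  ; few-monos = ≤ᵇ⇒≤ _ 5 tt
  }

family₃ : Family
family₃ = record
  { side  = 3
  ; core  = tet right (lo 0 , lo 0) ∷ tet up (lo 1 , lo 0) ∷ tet left (lo 3 , lo 0) ∷ tet right (lo 5 , lo 0)
          ∷ mon (lo 6 , lo 0) ∷ tet up (lo 1 , lo 2) ∷ tet left (lo 5 , lo 2)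
          ∷ mon (lo 0 , lo 3) ∷ tet down (lo 0 , lo 3) ∷ mon (lo 3 , lo 3) ∷ tet down (lo 3 , lo 3)
          ∷ tet up (lo 0 , lo 5) ∷ tet down (lo 2 , lo 5) ∷ tet up (lo 4 , lo 5) ∷ []
  ; ring  = tet up (lo 0 , lo 0) ∷ hstairs falling 2 (lo 0) ∷ tet down (hi 2 , lo 0) ∷ tet up (hi 4 , lo 0)
          ∷ hstairs falling 2 (hi 5) ∷ tet down (hi 2 , hi 5)
          ∷ vstairs rising (lo 0) 1 ∷ tet right (lo 0 , hi 1) ∷ tet down (lo 0 , hi 3) ∷ tet up (lo 0 , hi 5)
          ∷ vstairs falling (hi 5) 1 ∷ tet left (hi 5 , hi 1) ∷ tet down (hi 4 , hi 3) ∷ tet up (hi 4 , hi 5)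
          ∷ []
  ; holes = (lo 0 , hi 2) ∷ (hi 2 , hi 2) ∷ []
  ; core-fits = tt
  ; ring-fits = tt
  ; ring-tees = refl
  ; few-monos = ≤ᵇ⇒≤ _ 5 tt
  }

tiled₁ : Tiled 1
tiled₁ = fixed-tiled 1 (mon (lo 0 , lo 0) ∷ []) tt (≤ᵇ⇒≤ _ 5 tt)

tiled₂ : Tiled 2
tiled₂ = fixed-tiled 2
  (mon (lo 0 , lo 0) ∷ mon (lo 1 , lo 0) ∷ mon (lo 0 , lo 1) ∷ mon (lo 1 , lo 1) ∷ [])
  tt (≤ᵇ⇒≤ _ 5 tt)

tiled₃ : Tiled 3
tiled₃ = fixed-tiled 3
  (tet right (lo 0 , lo 0) ∷ mon (lo 1 , lo 0) ∷ mon (lo 2 , lo 0) ∷ mon (lo 2 , lo 1)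
   ∷ mon (lo 1 , lo 2) ∷ mon (lo 2 , lo 2) ∷ [])
  tt (≤ᵇ⇒≤ _ 5 tt)

tiled₅ : Tiled 5
tiled₅ = fixed-tiled 5
  (tet right (lo 0 , lo 0) ∷ tet up (lo 1 , lo 0) ∷ tet left (lo 3 , lo 0) ∷ tet up (lo 1 , lo 2)
   ∷ mon (lo 0 , lo 3) ∷ tet down (lo 0 , lo 3) ∷ mon (lo 3 , lo 3) ∷ mon (lo 4 , lo 3)
   ∷ mon (lo 3 , lo 4) ∷ mon (lo 4 , lo 4) ∷ [])
  tt (≤ᵇ⇒≤ _ 5 tt)

tiled-by-residue : ∀ r q → r < 4 → 0 < r + q * 4 → Tiled (r + q * 4)
tiled-by-residue 0 zero          _ ()
tiled-by-residue 0 (suc m)       _ _ = family-tiled family₀ m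
tiled-by-residue 1 zero          _ _ = tiled₁
tiled-by-residue 1 (suc zero)    _ _ = tiled₅
tiled-by-residue 1 (suc (suc m)) _ _ = family-tiled family₁ m
tiled-by-residue 2 zero          _ _ = tiled₂
tiled-by-residue 2 (suc m)       _ _ = family-tiled family₂ m
tiled-by-residue 3 zero          _ _ = tiled₃
tiled-by-residue 3 (suc m)       _ _ = family-tiled family₃ m
tiled-by-residue (suc (suc (suc (suc _)))) _ (s≤s (s≤s (s≤s (s≤s ())))) _

theorem1 : (n : ℕ) → 1 ≤ n → Σ (List Tile) λ T →
    IsTilingOf (InSquare n) T × (numMono T ≤ 5)
theorem1 n 0<n =
  subst Tiled (sym n≡r+q*4) (tiled-by-residue (n % 4) (n / 4) (m%n<n n 4) (subst (0 <_) n≡r+q*4 0<n))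
  where
  n≡r+q*4 : n ≡ n % 4 + n / 4 * 4
  n≡r+q*4 = m≡m%n+[m/n]*n n 4
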